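{- Let $k$ be a positive integer. If a hypergraph $\mathcal{H}$ contains a subhypergraph $\mathcal{H}'$ from $\mathcal{F}_k$, then ${\rm w}_M^M(\mathcal{H})\le k$.
   Context: Maker-Breaker game on a hypergraph $\mathcal{H}$ (with vertex set $V(\mathcal{H})$ and edge set $E(\mathcal{H})\subseteq 2^{V(\mathcal{H})}$): Maker and Breaker alternately claim unclaimed vertices; Maker wins when he has claimed all vertices of some hyperedge. ${\rm w}_M^M(\mathcal{H})$ is the minimum number of moves Maker needs to win when Maker starts and both play optimally (Maker minimizing, Breaker trying to prevent or delay his win); it is $\infty$ if Maker has no winning strategy. $\mathcal{H}_1$ is a subhypergraph of $\mathcal{H}_2$ if $V(\mathcal{H}_1)\subseteq V(\mathcal{H}_2)$ and $E(\mathcal{H}_1)\subseteq E(\mathcal{H}_2)$; "contains a subhypergraph from $\mathcal{F}_k$" means contains a subhypergraph isomorphic to a member of $\mathcal{F}_k$. The families $\mathcal{F}_k$ are defined recursively: $\mathcal{F}_1=\{\mathcal{B}\}$, where $\mathcal{B}$ has one vertex $x$ and one edge $\{x\}$. For $k\ge2$, $\mathcal{F}_k^*$ consists of all hypergraphs $\mathcal{A}$ obtained as follows: choose vertex-disjoint $\mathcal{A}_1\in\mathcal{F}_{k-1}$ and $\mathcal{A}_2\in\bigcup_{i=1}^{k-1}\mathcal{F}_i$, edges $e_1\in E(\mathcal{A}_1)$, $e_2\in E(\mathcal{A}_2)$, and a new vertex $u$; put $e_i'=e_i\cup\{u\}$ and set $V(\mathcal{A})=V(\mathcal{A}_1)\cup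 V(\mathcal{A}_2)\cup\{u\}$, $E(\mathcal{A})=(E(\mathcal{A}_1)\cup E(\mathcal{A}_2)\cup\{e_1',e_2'\})\setminus\{e_1,e_2\}$. Then $\mathcal{F}_k=\mathcal{F}_k^*\setminus\bigcup_{i=1}^{k-1}\mathcal{F}_i$. -}

module Defs where

open import Level using (Level; Lift; lift) renaming (suc to lsuc; zero to lzero)
open import Data.Nat using (ℕ; zero; suc; _+_)
open import Data.Fin using (Fin)
open import Data.Fin.Subset using (Subset; _∈_; _∉_; _⊆_; _∪_; ⁅_⁆)
  renaming (⊥ to ∅)
open import Data.Vec using (_∷_; _++_; tabulate; lookup)
open import Data.Bool using (true; false)
open import Data.Product using (Σ; _×_; _,_; ∃; ∃-syntax)
open import Data.Sum using (_⊎_)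
open import Data.Empty using (⊥)
open import Relation.Nullary using (¬_)
open import Relation.Binary.PropositionalEquality using (_≡_; _≢_)
open import Function.Definitions using (Injective)

record Hypergraph : Set₁ where
  field
    n    : ℕ
    Edge : Subset n → Set
open Hypergraph public

preimage : {n m : ℕ} → (Fin n → Fin m) → Subset m → Subset n
preimage f e = tabulate (λ x → lookup e (f x))

Iso : Hypergraph → Hypergraph → Set
Iso H A =
  Σ (Fin (n H) → Fin (n A)) λ f →
  Σ (Fin (n A) → Fin (n H)) λ g →
    (∀ x → g (f x) ≡ x) × (∀ y → f (g y) ≡ y) ×
    (∀ (e : Subset (n A)) → (Edge A e → Edge H (preimage f e))
                          × (Edge H (preimage f e) → Edge A e))

-- "H contains a subhypergraph isomorphic to A": an injective map
-- f : V(A) → V(H) sending every edge of A onto an edge of H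
-- (the subhypergraph is the image of A under f).

image : {n m : ℕ} → (Fin n → Fin m) → Subset n → Subset m
image {n} {m} f e = tabulate (λ y → imageBit y)
  where
  open import Data.Fin.Properties using (any?)
  open import Relation.Nullary using (does)
  open import Data.Fin using (_≟_)
  open import Data.Bool using (Bool; T)
  open import Relation.Nullary.Decidable using (_×-dec_)
  open import Data.Bool.Properties using (T?)
  imageBit : Fin m → Bool
  imageBit y = does (any? (λ x → (f x ≟ y) ×-dec T? (lookup e x)))

ContainsCopyOf : Hypergraph → Hypergraph → Set
ContainsCopyOf H A =
  Σ (Fin (n A) → Fin (n H)) λ f →
    Injective _≡_ _≡_ f × (∀ (e : Subset (n A)) → Edge A e → Edge H (image f e))

𝓑 : Hypergraph
𝓑 = record { n = 1 ; Edge = λ e → e ≡ ⁅ Fin.zero ⁆ }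
  where import Data.Fin as Fin

-- The gluing construction of F_k^*: vertices of A₁ and A₂ (disjoint),
-- plus a new vertex u (index 0); e₁, e₂ are replaced by e₁ ∪ {u}, e₂ ∪ {u}.
glue : (A₁ A₂ : Hypergraph) → Subset (n A₁) → Subset (n A₂) → Hypergraph
glue A₁ A₂ e₁ e₂ = record { n = suc (n A₁ + n A₂) ; Edge = E }
  where
  lift₁ : Subset (n A₁) → Subset (suc (n A₁ + n A₂))
  lift₁ d = false ∷ (d ++ ∅)
  lift₂ : Subset (n A₂) → Subset (suc (n A₁ + n A₂))
  lift₂ d = false ∷ (∅ ++ d)
  e₁′ e₂′ : Subset (suc (n A₁ + n A₂))
  e₁′ = true ∷ (e₁ ++ ∅)
  e₂′ = true ∷ (∅ ++ e₂)
  E : Subset (suc (n A₁ + n A₂)) → Set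
  E e = (e ≡ e₁′) ⊎ (e ≡ e₂′)
      ⊎ (Σ (Subset (n A₁)) λ d → Edge A₁ d × d ≢ e₁ × e ≡ lift₁ d)
      ⊎ (Σ (Subset (n A₂)) λ d → Edge A₂ d × d ≢ e₂ × e ≡ lift₂ d)

-- InF k H      : H ∈ F_k (up to isomorphism; F_0 is empty)
-- InFUpTo k H  : H ∈ F_1 ∪ … ∪ F_k
mutual
  InF : ℕ → Hypergraph → Set₁
  InF zero H = Lift (lsuc lzero) ⊥
  InF (suc zero) H = Lift (lsuc lzero) (Iso H 𝓑)
  InF (suc (suc k)) H = InFStar (suc k) H × ¬ InFUpTo (suc k) H

  -- InFStar k H : H ∈ F_{k+1}^*
  InFStar : ℕ → Hypergraph → Set₁
  InFStar k H =
    Σ Hypergraph λ A₁ → Σ Hypergraph λ A₂ →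
    Σ (Subset (n A₁)) λ e₁ → Σ (Subset (n A₂)) λ e₂ →
      InF k A₁ × InFUpTo k A₂ × Edge A₁ e₁ × Edge A₂ e₂ ×
      Lift (lsuc lzero) (Iso H (glue A₁ A₂ e₁ e₂))

  InFUpTo : ℕ → Hypergraph → Set₁
  InFUpTo zero H = Lift (lsuc lzero) ⊥
  InFUpTo (suc k) H = InFUpTo k H ⊎ InF (suc k) H

Won : (H : Hypergraph) → Subset (n H) → Set
Won H M = Σ (Subset (n H)) λ e → Edge H e × e ⊆ M

-- MakerWinsWithin H k M B : in the position where Maker owns M, Breaker
-- owns B and it is Maker's turn, Maker has a strategy guaranteeing that he
-- owns an edge after at most k further moves of his, whatever Breaker does.
-- (If the board is full and Maker has not won, Maker has lost.)
MakerWinsWithin : (H : Hypergraph) → ℕ → Subset (n H) → Subset (n H) → Set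
MakerWinsWithin H zero M B = Won H M
MakerWinsWithin H (suc k) M B =
  Won H M ⊎
  (Σ (Fin (n H)) λ v → v ∉ M × v ∉ B ×
     (Won H (M ∪ ⁅ v ⁆) ⊎
      ((Σ (Fin (n H)) λ w → w ∉ M ∪ ⁅ v ⁆ × w ∉ B) ×
       (∀ w → w ∉ M ∪ ⁅ v ⁆ → w ∉ B →
          MakerWinsWithin H k (M ∪ ⁅ v ⁆) (B ∪ ⁅ w ⁆)))))

-- w_M^M(H) ≤ k  (with w_M^M(H) = ∞ when Maker cannot win, this never holds then)
wMM≤ : Hypergraph → ℕ → Set
wMM≤ H k = MakerWinsWithin H k ∅ ∅

{-# OPTIONS --safe #-}
-- Maker wins from any position carrying an injective map φ of some A ∈ F_k onto free
-- vertices such that φ(e) together with Maker's vertices contains an edge of H, for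
-- every edge e of A.  For A = 𝓑 Maker claims the single vertex.  For A glued from
-- A₁ and A₂ at u, Maker claims φ(u); Breaker's reply hits the image of at most one
-- of A₁, A₂, and on the other the invariant holds again, because the glued edge
-- minus u is an original edge.  Since F_j wins within j ≤ k moves, the recursion
-- through F_1 ∪ … ∪ F_{k-1} goes through.
module Submission where

open import Defs
open import Level using (lift)
open import Data.Nat using (ℕ; _≥_; zero; suc; _+_)
open import Data.Fin using (Fin; zero; suc; _↑ˡ_; _↑ʳ_; splitAt; _≟_)
open import Data.Fin.Properties
  using (any?; suc-injective; ↑ˡ-injective; ↑ʳ-injective; splitAt-↑ˡ; splitAt-↑ʳ)
open import Data.Fin.Subset using (Subset; _∈_; _∉_; _⊆_; _∪_; ⁅_⁆) renaming (⊥ to ∅)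
open import Data.Fin.Subset.Properties using (∉⊥; x∈p∪q⁺; x∈p∪q⁻; x∈⁅x⁆; x∈⁅y⁆⇒x≡y; p⊆p∪q)
open import Data.Vec using ([]; _∷_; _++_; lookup; here; there)
open import Data.Vec.Properties using (lookup∘tabulate; []=⇒lookup; lookup⇒[]=; ≡-dec)
open import Data.Bool using (true)
open import Data.Bool.Properties using (T?; T-≡) renaming (_≟_ to _≟ᵇ_)
open import Data.Product using (Σ; _×_; _,_; proj₁; proj₂; ∃-syntax)
open import Data.Sum using (_⊎_; inj₁; inj₂)
open import Data.Empty using (⊥-elim)
open import Function using (_∘_; Equivalence)
open import Function.Definitions using (Injective)
open import Relation.Nullary using (Dec; yes; no; does)
open import Relation.Nullary.Decidable using (_×-dec_)
open import Relation.Binary.PropositionalEquality using (_≡_; _≢_; refl; sym; trans; cong)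

private variable
  m₁ m₂ : ℕ

dec-true⁻¹ : {P : Set} (P? : Dec P) → does P? ≡ true → P
dec-true⁻¹ (yes p) _ = p

∈-++⁻ : (p : Subset m₁) (q : Subset m₂) {z : Fin (m₁ + m₂)} → z ∈ p ++ q →
        (∃[ a ] a ∈ p × a ↑ˡ m₂ ≡ z) ⊎ (∃[ b ] b ∈ q × m₁ ↑ʳ b ≡ z)
∈-++⁻ []      q z∈q          = inj₂ (_ , z∈q , refl)
∈-++⁻ (_ ∷ p) q here         = inj₁ (zero , here , refl)
∈-++⁻ (_ ∷ p) q (there z∈pq) with ∈-++⁻ p q z∈pq
... | inj₁ (a , a∈p , refl) = inj₁ (suc a , there a∈p , refl)
... | inj₂ (b , b∈q , refl) = inj₂ (b , b∈q , refl)

↑ˡ≢↑ʳ : (a : Fin m₁) (b : Fin m₂) → a ↑ˡ m₂ ≢ m₁ ↑ʳ b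
↑ˡ≢↑ʳ {m₁} {m₂} a b eq
  with trans (sym (splitAt-↑ˡ m₁ a m₂)) (trans (cong (splitAt m₁) eq) (splitAt-↑ʳ m₁ m₂ b))
... | ()

∉-∪⁅⁆ : {p : Subset m₁} {x y : Fin m₁} → x ∉ p → x ≢ y → x ∉ p ∪ ⁅ y ⁆
∉-∪⁅⁆ {p = p} {y = y} x∉p x≢y x∈ with x∈p∪q⁻ p ⁅ y ⁆ x∈
... | inj₁ x∈p = x∉p x∈p
... | inj₂ x∈y = x≢y (x∈⁅y⁆⇒x≡y y x∈y)

∈-preimage⁻ : (f : Fin m₁ → Fin m₂) (e : Subset m₂) {x : Fin m₁} → x ∈ preimage f e → f x ∈ e
∈-preimage⁻ f e {x} x∈ =
  lookup⇒[]= (f x) e (trans (sym (lookup∘tabulate (lookup e ∘ f) x)) ([]=⇒lookup x∈))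

∈-image⁻ : (f : Fin m₁ → Fin m₂) (e : Subset m₁) {y : Fin m₂} →
           y ∈ image f e → ∃[ x ] x ∈ e × f x ≡ y
∈-image⁻ f e {y} y∈ with dec-true⁻¹ (any? (λ x → (f x ≟ y) ×-dec T? (lookup e x)))
                         (trans (sym (lookup∘tabulate _ y)) ([]=⇒lookup y∈))
... | x , fx≡y , x∈e = x , lookup⇒[]= x e (Equivalence.to T-≡ x∈e) , fx≡y

MapsEdges : (A H : Hypergraph) → Subset (n H) → (Fin (n A) → Fin (n H)) → Set
MapsEdges A H M φ =
  ∀ e → Edge A e → ∃[ e′ ] Edge H e′ × (∀ {y} → y ∈ e′ → y ∈ M ⊎ ∃[ x ] x ∈ e × φ x ≡ y)

MapsEdges-∘ : ∀ {G A H : Hypergraph} {U M M′} {ι : Fin (n G) → Fin (n A)} {φ : Fin (n A) → Fin (n H)} →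
  MapsEdges G A U ι → MapsEdges A H M φ → M ⊆ M′ → (∀ {x} → x ∈ U → φ x ∈ M′) →
  MapsEdges G H M′ (φ ∘ ι)
MapsEdges-∘ {M = M} {M′} {ι} {φ} ι-edges φ-edges M⊆M′ φ[U]⊆M′ e e∈G with ι-edges e e∈G
... | d , d∈A , d⊆ with φ-edges d d∈A
... | e′ , e′∈H , e′⊆ = e′ , e′∈H , λ y∈e′ → covered (e′⊆ y∈e′)
  where
  covered : ∀ {y} → y ∈ M ⊎ ∃[ x ] x ∈ d × φ x ≡ y → y ∈ M′ ⊎ ∃[ z ] z ∈ e × φ (ι z) ≡ y
  covered (inj₁ y∈M) = inj₁ (M⊆M′ y∈M)
  covered (inj₂ (x , x∈d , refl)) with d⊆ x∈d
  ... | inj₁ x∈U              = inj₁ (φ[U]⊆M′ x∈U)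
  ... | inj₂ (z , z∈e , refl) = inj₂ (z , z∈e , refl)

record Embedding (A H : Hypergraph) (M B : Subset (n H)) : Set where
  field
    φ         : Fin (n A) → Fin (n H)
    injective : Injective _≡_ _≡_ φ
    φ∉M       : ∀ x → φ x ∉ M
    φ∉B       : ∀ x → φ x ∉ B
    mapsEdges : MapsEdges A H M φ

restrict : ∀ {G A H M B M′ B′ U} (E : Embedding A H M B) (ι : Fin (n G) → Fin (n A)) →
  Injective _≡_ _≡_ ι → MapsEdges G A U ι →
  M ⊆ M′ → (∀ {x} → x ∈ U → Embedding.φ E x ∈ M′) →
  (∀ z → Embedding.φ E (ι z) ∉ M′) → (∀ z → Embedding.φ E (ι z) ∉ B′) →
  Embedding G H M′ B′
restrict E ι ι-injective ι-edges M⊆M′ φ[U]⊆M′ ∉M′ ∉B′ = record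
  { φ         = φ ∘ ι
  ; injective = ι-injective ∘ injective
  ; φ∉M       = ∉M′
  ; φ∉B       = ∉B′
  ; mapsEdges = MapsEdges-∘ ι-edges mapsEdges M⊆M′ φ[U]⊆M′
  }
  where open Embedding E

copy⇒Embedding : ∀ {H A} → ContainsCopyOf H A → Embedding A H ∅ ∅
copy⇒Embedding (f , f-injective , edges) = record
  { φ         = f
  ; injective = f-injective
  ; φ∉M       = λ _ → ∉⊥
  ; φ∉B       = λ _ → ∉⊥
  ; mapsEdges = λ e e∈A → image f e , edges e e∈A , inj₂ ∘ ∈-image⁻ f e
  }

MakerForces : Hypergraph → ℕ → Set₁
MakerForces A k = ∀ {H M B} → Embedding A H M B → MakerWinsWithin H k M B

winsWithin-suc : ∀ {H} k {M B} → MakerWinsWithin H k M B → MakerWinsWithin H (suc k) M B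
winsWithin-suc zero    won = inj₁ won
winsWithin-suc (suc k) (inj₁ won) = inj₁ won
winsWithin-suc (suc k) (inj₂ (v , v∉M , v∉B , inj₁ won)) = inj₂ (v , v∉M , v∉B , inj₁ won)
winsWithin-suc (suc k) (inj₂ (v , v∉M , v∉B , inj₂ (free , wins))) =
  inj₂ (v , v∉M , v∉B , inj₂ (free , λ w w∉M w∉B → winsWithin-suc k (wins w w∉M w∉B)))

Iso⇒MapsEdges : ∀ {A G} (iso : Iso A G) → MapsEdges G A ∅ (proj₁ (proj₂ iso))
Iso⇒MapsEdges (f , g , g∘f , _ , edges) e e∈G =
  preimage f e , proj₁ (edges e) e∈G , λ {x} x∈ → inj₂ (f x , ∈-preimage⁻ f e x∈ , g∘f x)

Iso-forces : ∀ {A G k} → Iso A G → MakerForces G k → MakerForces A k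
Iso-forces iso@(f , g , _ , f∘g , _) G-forces E =
  G-forces (restrict E g g-injective (Iso⇒MapsEdges iso) (λ x∈M → x∈M) (⊥-elim ∘ ∉⊥)
                     (φ∉M ∘ g) (φ∉B ∘ g))
  where
  open Embedding E
  g-injective : Injective _≡_ _≡_ g
  g-injective {y} {y′} gy≡gy′ = trans (sym (f∘g y)) (trans (cong f gy≡gy′) (f∘g y′))

𝓑-forces : MakerForces 𝓑 1
𝓑-forces {H} {M} E = inj₂ (v , φ∉M zero , φ∉B zero , inj₁ won)
  where
  open Embedding E
  v = φ zero
  claimed : ∀ {y} → y ∈ M ⊎ ∃[ x ] x ∈ ⁅ zero ⁆ × φ x ≡ y → y ∈ M ⊎ y ∈ ⁅ v ⁆
  claimed (inj₁ y∈M)               = inj₁ y∈M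
  claimed (inj₂ (zero , _ , refl)) = inj₂ (x∈⁅x⁆ v)
  won : Won H (M ∪ ⁅ v ⁆)
  won = let e′ , e′∈H , e′⊆ = mapsEdges ⁅ zero ⁆ refl in
        e′ , e′∈H , x∈p∪q⁺ ∘ claimed ∘ e′⊆

∈-∷-++∅⁻ : ∀ {b} (p : Subset m₁) {x : Fin (suc (m₁ + m₂))} → x ∈ b ∷ (p ++ ∅) →
           x ∈ ⁅ zero ⁆ ⊎ ∃[ a ] a ∈ p × suc (a ↑ˡ m₂) ≡ x
∈-∷-++∅⁻ p here = inj₁ (x∈⁅x⁆ zero)
∈-∷-++∅⁻ p (there x∈) with ∈-++⁻ p ∅ x∈
... | inj₁ (a , a∈p , refl) = inj₂ (a , a∈p , refl)
... | inj₂ (_ , b∈∅ , _)    = ⊥-elim (∉⊥ b∈∅)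

∈-∷-∅++⁻ : ∀ {b} (q : Subset m₂) {x : Fin (suc (m₁ + m₂))} → x ∈ b ∷ (∅ ++ q) →
           x ∈ ⁅ zero ⁆ ⊎ ∃[ c ] c ∈ q × suc (m₁ ↑ʳ c) ≡ x
∈-∷-∅++⁻ q here = inj₁ (x∈⁅x⁆ zero)
∈-∷-∅++⁻ q (there x∈) with ∈-++⁻ ∅ q x∈
... | inj₁ (_ , a∈∅ , _)    = ⊥-elim (∉⊥ a∈∅)
... | inj₂ (c , c∈q , refl) = inj₂ (c , c∈q , refl)

module Gluing (A₁ A₂ : Hypergraph) (e₁ : Subset (n A₁)) (e₂ : Subset (n A₂)) where

  G : Hypergraph
  G = glue A₁ A₂ e₁ e₂

  ι₁ : Fin (n A₁) → Fin (n G)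
  ι₁ a = suc (a ↑ˡ n A₂)

  ι₂ : Fin (n A₂) → Fin (n G)
  ι₂ b = suc (n A₁ ↑ʳ b)

  ι₁-injective : Injective _≡_ _≡_ ι₁
  ι₁-injective = ↑ˡ-injective (n A₂) _ _ ∘ suc-injective

  ι₂-injective : Injective _≡_ _≡_ ι₂
  ι₂-injective = ↑ʳ-injective (n A₁) _ _ ∘ suc-injective

  ι₁≢ι₂ : ∀ a b → ι₁ a ≢ ι₂ b
  ι₁≢ι₂ a b = ↑ˡ≢↑ʳ a b ∘ suc-injective

  ι₁-mapsEdges : MapsEdges A₁ G ⁅ zero ⁆ ι₁
  ι₁-mapsEdges d d∈A₁ with ≡-dec _≟ᵇ_ d e₁
  ... | yes refl = _ , inj₁ refl , ∈-∷-++∅⁻ d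
  ... | no d≢e₁  = _ , inj₂ (inj₂ (inj₁ (d , d∈A₁ , d≢e₁ , refl))) , ∈-∷-++∅⁻ d

  ι₂-mapsEdges : MapsEdges A₂ G ⁅ zero ⁆ ι₂
  ι₂-mapsEdges d d∈A₂ with ≡-dec _≟ᵇ_ d e₂
  ... | yes refl = _ , inj₂ (inj₁ refl) , ∈-∷-∅++⁻ d
  ... | no d≢e₂  = _ , inj₂ (inj₂ (inj₂ (d , d∈A₂ , d≢e₂ , refl))) , ∈-∷-∅++⁻ d

  glue-forces : ∀ {k} → Fin (n A₂) → MakerForces A₁ (suc k) → MakerForces A₂ (suc k) →
                MakerForces G (suc (suc k))
  glue-forces {k} b₀ A₁-forces A₂-forces {H} {M} {B} E =
    inj₂ (v , φ∉M zero , φ∉B zero , inj₂ ((φ (ι₂ b₀) , ∉M∪v (ι₂ b₀) (λ ()) , φ∉B _) , reply))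
    where
    open Embedding E
    v = φ zero
    ∉M∪v : ∀ x → x ≢ zero → φ x ∉ M ∪ ⁅ v ⁆
    ∉M∪v x x≢zero = ∉-∪⁅⁆ (φ∉M x) (x≢zero ∘ injective)
    φ[u]∈M∪v : ∀ {x} → x ∈ ⁅ zero ⁆ → φ x ∈ M ∪ ⁅ v ⁆
    φ[u]∈M∪v x∈ rewrite x∈⁅y⁆⇒x≡y zero x∈ = x∈p∪q⁺ (inj₂ (x∈⁅x⁆ v))
    reply : ∀ w → w ∉ M ∪ ⁅ v ⁆ → w ∉ B → MakerWinsWithin H (suc k) (M ∪ ⁅ v ⁆) (B ∪ ⁅ w ⁆)
    reply w _ _ with any? (λ b → φ (ι₂ b) ≟ w)
    ... | yes (b , refl) =
      A₁-forces (restrict E ι₁ ι₁-injective ι₁-mapsEdges (p⊆p∪q _) φ[u]∈M∪v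
                  (λ a → ∉M∪v (ι₁ a) (λ ()))
                  (λ a → ∉-∪⁅⁆ (φ∉B (ι₁ a)) (ι₁≢ι₂ a b ∘ injective)))
    ... | no w∉φ[ι₂] =
      A₂-forces (restrict E ι₂ ι₂-injective ι₂-mapsEdges (p⊆p∪q _) φ[u]∈M∪v
                  (λ b → ∉M∪v (ι₂ b) (λ ()))
                  (λ b → ∉-∪⁅⁆ (φ∉B (ι₂ b)) (λ φι₂b≡w → w∉φ[ι₂] (b , φι₂b≡w))))

InF-vertex : ∀ k {A} → InF (suc k) A → Fin (n A)
InF-vertex zero    (lift (_ , g , _))                                     = g zero
InF-vertex (suc k) ((_ , _ , _ , _ , _ , _ , _ , _ , lift (_ , g , _)) , _) = g zero

InFUpTo-vertex : ∀ k {A} → InFUpTo (suc k) A → Fin (n A)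
InFUpTo-vertex k       (inj₂ A∈F)  = InF-vertex k A∈F
InFUpTo-vertex (suc k) (inj₁ A∈F≤) = InFUpTo-vertex k A∈F≤

mutual
  InF-forces : ∀ k {A} → InF (suc k) A → MakerForces A (suc k)
  InF-forces zero    (lift iso) = Iso-forces iso 𝓑-forces
  InF-forces (suc k) ((A₁ , A₂ , e₁ , e₂ , A₁∈F , A₂∈F≤ , _ , _ , lift iso) , _) =
    Iso-forces iso (Gluing.glue-forces A₁ A₂ e₁ e₂ (InFUpTo-vertex k A₂∈F≤)
                      (InF-forces k A₁∈F) (InFUpTo-forces k A₂∈F≤))

  InFUpTo-forces : ∀ k {A} → InFUpTo (suc k) A → MakerForces A (suc k)
  InFUpTo-forces k       (inj₂ A∈F)    = InF-forces k A∈F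
  InFUpTo-forces (suc k) (inj₁ A∈F≤) E = winsWithin-suc (suc k) (InFUpTo-forces k A∈F≤ E)

proposition15 : (k : ℕ) → k ≥ 1 → (H : Hypergraph) →
    Σ Hypergraph (λ A → InF k A × ContainsCopyOf H A) → wMM≤ H k
proposition15 (suc k) _ H (A , A∈F , copy) = InF-forces k A∈F (copy⇒Embedding copy)
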